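{- Let $n\ge 0$ and $a,b\in\mathbb{Z}$. Then $a+bi \in A_{\mathbb{Z}[i],n}$ if and only if all of $\pm a \pm bi$ and $\pm b \pm ai$ lie in $A_{\mathbb{Z}[i],n}$.
   Context: $A_{\mathbb{Z}[i],0} = \{0,\pm 1,\pm i\}$, and for $n\ge 1$, $A_{\mathbb{Z}[i],n} = A_{\mathbb{Z}[i],n-1} \cup \{\beta \in \mathbb{Z}[i] : \text{every residue class of } \mathbb{Z}[i]/(\beta) \text{ has a representative in } A_{\mathbb{Z}[i],n-1}\}$. -}

module Defs where

open import Data.Integer using (ℤ; +_; -[1+_]; _+_; _*_; -_; _-_)
open import Data.Product using (Σ; ∃; _×_; _,_)
open import Data.Sum using (_⊎_)
open import Relation.Binary.PropositionalEquality using (_≡_)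
open import Data.Nat using (ℕ; zero; suc)

record ℤ[i] : Set where
  constructor _+_i
  field
    re : ℤ
    im : ℤ

open ℤ[i] public

infixl 6 _+ᵍ_ _-ᵍ_
infixl 7 _*ᵍ_

_+ᵍ_ : ℤ[i] → ℤ[i] → ℤ[i]
(a + b i) +ᵍ (c + d i) = (a + c) + (b + d) i

-ᵍ_ : ℤ[i] → ℤ[i]
-ᵍ (a + b i) = (- a) + (- b) i

_-ᵍ_ : ℤ[i] → ℤ[i] → ℤ[i]
x -ᵍ y = x +ᵍ (-ᵍ y)

_*ᵍ_ : ℤ[i] → ℤ[i] → ℤ[i]
(a + b i) *ᵍ (c + d i) = (a * c - b * d) + (a * d + b * c) i

_∣ᵍ_ : ℤ[i] → ℤ[i] → Set
β ∣ᵍ x = ∃ λ γ → x ≡ β *ᵍ γ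

_≡_[modᵍ_] : ℤ[i] → ℤ[i] → ℤ[i] → Set
x ≡ y [modᵍ β ] = β ∣ᵍ (x -ᵍ y)

A₀ : ℤ[i] → Set
A₀ x = (x ≡ (+ 0) + (+ 0) i) ⊎ (x ≡ (+ 1) + (+ 0) i) ⊎ (x ≡ (- (+ 1)) + (+ 0) i)
     ⊎ (x ≡ (+ 0) + (+ 1) i) ⊎ (x ≡ (+ 0) + (- (+ 1)) i)

A : ℕ → ℤ[i] → Set
A zero x = A₀ x
A (suc n) β = A n β ⊎ ((α : ℤ[i]) → ∃ λ γ → A n γ × (α ≡ γ [modᵍ β ]))

{-# OPTIONS --safe #-}
module Submission where

-- The eight numbers ±a ± bi, ±b ± ai are the images of a + bi under the group generated
-- by the reflections x̄, −x̄ and i·x̄. Each such reflection σ is an additive involution with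
-- σ (β γ) = σ β · γ̄, so it carries x ≡ y (mod β) to σ x ≡ σ y (mod σ β), and it permutes
-- {0, ±1, ±i}; by induction on n it therefore maps A n into itself.

open import Defs
open import Data.Nat using (ℕ; zero; suc)
open import Data.Integer using (ℤ; -_)
import Data.Integer as ℤ
open import Data.Integer.Properties using (neg-involutive; neg-distrib-+)
open import Data.Integer.Tactic.RingSolver using (solve-∀)
open import Data.Product using (_×_; _,_; proj₁)
open import Data.Sum using (inj₁; inj₂)
open import Function.Bundles using (_⇔_; mk⇔)
open import Relation.Binary.PropositionalEquality using (_≡_; refl; cong; cong₂; trans; sym; subst)

≡-ℤ[i] : ∀ {a b c d} → a ≡ c → b ≡ d → a + b i ≡ c + d i
≡-ℤ[i] = cong₂ _+_i

record IsSymmetry (σ : ℤ[i] → ℤ[i]) : Set where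
  field
    involutive   : ∀ x → σ (σ x) ≡ x
    -ᵍ-homo      : ∀ x y → σ (x -ᵍ y) ≡ σ x -ᵍ σ y
    ∣ᵍ-preserved : ∀ β {x} → β ∣ᵍ x → σ β ∣ᵍ σ x
    A₀-closed    : ∀ {x} → A₀ x → A₀ (σ x)

  ≡-modᵍ-preserved : ∀ β {x y} → x ≡ y [modᵍ β ] → σ x ≡ σ y [modᵍ σ β ]
  ≡-modᵍ-preserved β {x} {y} x≡y with ∣ᵍ-preserved β x≡y
  ... | δ , eq = δ , trans (sym (-ᵍ-homo x y)) eq

  A-closed : ∀ n {x} → A n x → A n (σ x)
  A-closed zero    h         = A₀-closed h
  A-closed (suc n) (inj₁ h)  = inj₁ (A-closed n h)
  -- A representative of σ α modulo β is carried by σ to one of α = σ (σ α) modulo σ β.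
  A-closed (suc n) {β} (inj₂ complete) = inj₂ λ α →
    let (γ , γ∈A , σα≡γ) = complete (σ α)
    in σ γ , A-closed n γ∈A
           , subst (_≡ σ γ [modᵍ σ β ]) (involutive α) (≡-modᵍ-preserved β σα≡γ)

∣ᵍ-preserved-by-twisted-*ᵍ : ∀ {σ τ : ℤ[i] → ℤ[i]} →
  (∀ β γ → σ (β *ᵍ γ) ≡ σ β *ᵍ τ γ) → ∀ β {x} → β ∣ᵍ x → σ β ∣ᵍ σ x
∣ᵍ-preserved-by-twisted-*ᵍ {τ = τ} twisted β (γ , refl) = τ γ , twisted β γ

conj negConj swap : ℤ[i] → ℤ[i]
conj    (a + b i) = a + (- b) i
negConj (a + b i) = (- a) + b i
swap    (a + b i) = b + a i

conj-*ᵍ : ∀ β γ → conj (β *ᵍ γ) ≡ conj β *ᵍ conj γ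
conj-*ᵍ (p + q i) (c + d i) = ≡-ℤ[i] (re-identity p q c d) (im-identity p q c d)
  where
  re-identity : ∀ p q c d → p ℤ.* c ℤ.- q ℤ.* d ≡ p ℤ.* c ℤ.- (- q) ℤ.* (- d)
  re-identity = solve-∀
  im-identity : ∀ p q c d → - (p ℤ.* d ℤ.+ q ℤ.* c) ≡ p ℤ.* (- d) ℤ.+ (- q) ℤ.* c
  im-identity = solve-∀

negConj-*ᵍ : ∀ β γ → negConj (β *ᵍ γ) ≡ negConj β *ᵍ conj γ
negConj-*ᵍ (p + q i) (c + d i) = ≡-ℤ[i] (re-identity p q c d) (im-identity p q c d)
  where
  re-identity : ∀ p q c d → - (p ℤ.* c ℤ.- q ℤ.* d) ≡ (- p) ℤ.* c ℤ.- q ℤ.* (- d)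
  re-identity = solve-∀
  im-identity : ∀ p q c d → p ℤ.* d ℤ.+ q ℤ.* c ≡ (- p) ℤ.* (- d) ℤ.+ q ℤ.* c
  im-identity = solve-∀

swap-*ᵍ : ∀ β γ → swap (β *ᵍ γ) ≡ swap β *ᵍ conj γ
swap-*ᵍ (p + q i) (c + d i) = ≡-ℤ[i] (re-identity p q c d) (im-identity p q c d)
  where
  re-identity : ∀ p q c d → p ℤ.* d ℤ.+ q ℤ.* c ≡ q ℤ.* c ℤ.- p ℤ.* (- d)
  re-identity = solve-∀
  im-identity : ∀ p q c d → p ℤ.* c ℤ.- q ℤ.* d ≡ q ℤ.* (- d) ℤ.+ p ℤ.* c
  im-identity = solve-∀

conj-isSymmetry : IsSymmetry conj
conj-isSymmetry = record
  { involutive   = λ { (a + b i) → cong (a +_i) (neg-involutive b) }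
  ; -ᵍ-homo      = λ { (a + b i) (c + d i) → cong ((a ℤ.+ - c) +_i) (neg-distrib-+ b (- d)) }
  ; ∣ᵍ-preserved = ∣ᵍ-preserved-by-twisted-*ᵍ conj-*ᵍ
  ; A₀-closed    = λ
      { (inj₁ refl)                      → inj₁ refl
      ; (inj₂ (inj₁ refl))               → inj₂ (inj₁ refl)
      ; (inj₂ (inj₂ (inj₁ refl)))        → inj₂ (inj₂ (inj₁ refl))
      ; (inj₂ (inj₂ (inj₂ (inj₁ refl)))) → inj₂ (inj₂ (inj₂ (inj₂ refl)))
      ; (inj₂ (inj₂ (inj₂ (inj₂ refl)))) → inj₂ (inj₂ (inj₂ (inj₁ refl)))
      }
  }

negConj-isSymmetry : IsSymmetry negConj
negConj-isSymmetry = record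
  { involutive   = λ { (a + b i) → cong (_+ b i) (neg-involutive a) }
  ; -ᵍ-homo      = λ { (a + b i) (c + d i) → cong (_+ (b ℤ.+ - d) i) (neg-distrib-+ a (- c)) }
  ; ∣ᵍ-preserved = ∣ᵍ-preserved-by-twisted-*ᵍ negConj-*ᵍ
  ; A₀-closed    = λ
      { (inj₁ refl)                      → inj₁ refl
      ; (inj₂ (inj₁ refl))               → inj₂ (inj₂ (inj₁ refl))
      ; (inj₂ (inj₂ (inj₁ refl)))        → inj₂ (inj₁ refl)
      ; (inj₂ (inj₂ (inj₂ (inj₁ refl)))) → inj₂ (inj₂ (inj₂ (inj₁ refl)))
      ; (inj₂ (inj₂ (inj₂ (inj₂ refl)))) → inj₂ (inj₂ (inj₂ (inj₂ refl)))
      }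
  }

swap-isSymmetry : IsSymmetry swap
swap-isSymmetry = record
  { involutive   = λ _ → refl
  ; -ᵍ-homo      = λ _ _ → refl
  ; ∣ᵍ-preserved = ∣ᵍ-preserved-by-twisted-*ᵍ swap-*ᵍ
  ; A₀-closed    = λ
      { (inj₁ refl)                      → inj₁ refl
      ; (inj₂ (inj₁ refl))               → inj₂ (inj₂ (inj₂ (inj₁ refl)))
      ; (inj₂ (inj₂ (inj₁ refl)))        → inj₂ (inj₂ (inj₂ (inj₂ refl)))
      ; (inj₂ (inj₂ (inj₂ (inj₁ refl)))) → inj₂ (inj₁ refl)
      ; (inj₂ (inj₂ (inj₂ (inj₂ refl)))) → inj₂ (inj₂ (inj₁ refl))
      }
  }

mainTheorem7 : (n : ℕ) (a b : ℤ) →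
    A n (a + b i) ⇔
      ( A n (a + b i) × A n (a + (- b) i) × A n ((- a) + b i) × A n ((- a) + (- b) i)
      × A n (b + a i) × A n (b + (- a) i) × A n ((- b) + a i) × A n ((- b) + (- a) i) )
mainTheorem7 n a b = mk⇔
  (λ h → h , conj-A h , negConj-A h , negConj-A (conj-A h)
       , swap-A h , conj-A (swap-A h) , negConj-A (swap-A h) , negConj-A (conj-A (swap-A h)))
  proj₁
  where
  open IsSymmetry using (A-closed)
  conj-A : ∀ {x} → A n x → A n (conj x)
  conj-A = A-closed conj-isSymmetry n
  negConj-A : ∀ {x} → A n x → A n (negConj x)
  negConj-A = A-closed negConj-isSymmetry n
  swap-A : ∀ {x} → A n x → A n (swap x)
  swap-A = A-closed swap-isSymmetry n
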